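{- Any DFA solving $A^{k}=(A_{yes}^{k},A_{no}^{k})$ exactly must have at least $2^{k+1}$ states.
   Context: Let $k$ be a positive integer and let $A_{yes}^{k}=\{a^{i2^{k}} \mid i \text{ is a nonnegative even integer}\}$ and $A_{no}^{k}=\{a^{i2^{k}} \mid i \text{ is a positive odd integer}\}$ be unary languages over $\Sigma=\{a\}$. A promise problem $(A_{yes},A_{no})$ is solved exactly by a machine if every string in $A_{yes}$ is accepted and every string in $A_{no}$ is rejected. A DFA here is a realtime deterministic finite automaton reading the input $\text{¢}w\$$ (¢ and $\$$ being the left- and right-end markers), moving its head one square right each step and stopping after reading $\$$. -}

module Defs where

open import Data.Nat using (ℕ; zero; suc; _*_; _+_; _^_)
open import Data.Fin using (Fin)
open import Data.Bool using (Bool; true; false)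
open import Data.Product using (_×_)
open import Relation.Binary.PropositionalEquality using (_≡_)

data Sym : Set where
  cent  : Sym
  a     : Sym
  dollar : Sym

record DFA (n : ℕ) : Set where
  field
    start  : Fin n
    δ      : Fin n → Sym → Fin n
    accept : Fin n → Bool

open DFA public

readAs : ∀ {n} → DFA n → Fin n → ℕ → Fin n
readAs D q zero    = q
readAs D q (suc m) = readAs D (δ D q a) m

accepts : ∀ {n} → DFA n → ℕ → Bool
accepts D m = accept D (δ D (readAs D (δ D (start D) cent) m) dollar)

-- A_yes^k = { a^(i 2^k) | i nonnegative even },  A_no^k = { a^(i 2^k) | i positive odd }.
-- Exact solution: accept every yes-instance, reject every no-instance.
SolvesExactly : ∀ {n} → DFA n → ℕ → Set
SolvesExactly D k =
  (∀ (j : ℕ) → accepts D ((2 * j) * 2 ^ k) ≡ true) ×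
  (∀ (j : ℕ) → accepts D ((2 * j + 1) * 2 ^ k) ≡ false)

-- After ¢ the automaton only reads a's, so by pigeonhole the states after ¢a^i and ¢a^j coincide
-- for some i < j ≤ n; from then on the run is periodic with period p = j − i, hence also with
-- every multiple of p. If 2^(k+1) ∤ p, some multiple of p equals an odd multiple of 2^k; adding it
-- to the yes-instance a^(2i·2^k) gives a no-instance in the same state, which is impossible.
-- So 2^(k+1) ∣ p, and 2^(k+1) ≤ p ≤ n.
module Submission where

open import Defs
open import Data.Nat using (ℕ; zero; suc; _+_; _*_; _∸_; _^_; _≤_; _<_; >-nonZero)
open import Data.Nat.Properties
open import Data.Nat.Divisibility using (_∣_; divides; ∣⇒≤)
open import Data.Fin using (Fin; toℕ)
open import Data.Fin.Properties using (pigeonhole; toℕ≤pred[n])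
open import Data.Product using (∃; ∃₂; _×_; _,_)
open import Data.Sum using (_⊎_; inj₁; inj₂)
open import Data.Bool using (true; false)
open import Data.Empty using (⊥-elim)
open import Function using (_∘_; case_of_)
open import Relation.Nullary using (¬_)
open import Relation.Binary.PropositionalEquality
open import Algebra.Properties.CommutativeSemigroup *-commutativeSemigroup using (x∙yz≈y∙xz)
open ≡-Reasoning

even-or-odd : ∀ n → (∃ λ r → n ≡ 2 * r) ⊎ (∃ λ r → n ≡ 2 * r + 1)
even-or-odd zero = inj₁ (0 , refl)
even-or-odd (suc n) with even-or-odd n
... | inj₁ (r , refl) = inj₂ (r , +-comm 1 (2 * r))
... | inj₂ (r , refl) = inj₁ (suc r , cong suc (trans (+-comm (2 * r) 1) (sym (+-suc r (r + 0)))))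

pow-∣-or-odd-multiple : ∀ k p → 2 ^ suc k ∣ p ⊎ ∃₂ λ c r → c * p ≡ (2 * r + 1) * 2 ^ k
pow-∣-or-odd-multiple zero p with even-or-odd p
... | inj₁ (r , refl) = inj₁ (divides r (*-comm 2 r))
... | inj₂ (r , refl) = inj₂ (1 , r , trans (*-identityˡ p) (sym (*-identityʳ p)))
pow-∣-or-odd-multiple (suc k) p with pow-∣-or-odd-multiple k p
... | inj₂ (c , r , c*p≡odd) = inj₂ (2 * c , r , (begin
  2 * c * p                 ≡⟨ *-assoc 2 c p ⟩
  2 * (c * p)               ≡⟨ cong (2 *_) c*p≡odd ⟩
  2 * ((2 * r + 1) * 2 ^ k) ≡⟨ x∙yz≈y∙xz 2 (2 * r + 1) (2 ^ k) ⟩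
  (2 * r + 1) * 2 ^ suc k   ∎))
... | inj₁ (divides q p≡q*2^[k+1]) with even-or-odd q
...   | inj₁ (s , refl) = inj₁ (divides s (trans p≡q*2^[k+1] (begin
  2 * s * 2 ^ suc k   ≡⟨ cong (_* 2 ^ suc k) (*-comm 2 s) ⟩
  s * 2 * 2 ^ suc k   ≡⟨ *-assoc s 2 (2 ^ suc k) ⟩
  s * 2 ^ suc (suc k) ∎)))
...   | inj₂ (r , refl) = inj₂ (1 , r , trans (*-identityˡ p) p≡q*2^[k+1])

EventuallyPeriodic : ∀ {A : Set} → (ℕ → A) → ℕ → ℕ → Set
EventuallyPeriodic f i p = ∀ m → i ≤ m → f (m + p) ≡ f m

periodic-* : ∀ {A : Set} {f : ℕ → A} {i p} →
  EventuallyPeriodic f i p → ∀ t → EventuallyPeriodic f i (t * p)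
periodic-* {f = f} per zero m _ = cong f (+-identityʳ m)
periodic-* {f = f} {p = p} per (suc t) m i≤m = begin
  f (m + (p + t * p)) ≡⟨ cong f (sym (+-assoc m p (t * p))) ⟩
  f (m + p + t * p)   ≡⟨ periodic-* per t (m + p) (≤-trans i≤m (m≤m+n m p)) ⟩
  f (m + p)           ≡⟨ per m i≤m ⟩
  f m                 ∎

repeats-within : ∀ {n} (f : ℕ → Fin n) → ∃₂ λ i j → i < j × j ≤ n × f i ≡ f j
repeats-within {n} f with x , y , x<y , fx≡fy ← pigeonhole (n<1+n n) (f ∘ toℕ)
  = toℕ x , toℕ y , x<y , toℕ≤pred[n] y , fx≡fy

readAs-+ : ∀ {n} (D : DFA n) q m d → readAs D q (m + d) ≡ readAs D (readAs D q m) d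
readAs-+ D q zero    d = refl
readAs-+ D q (suc m) d = readAs-+ D (δ D q a) m d

repeated-state⇒periodic : ∀ {n} (D : DFA n) q {i j} → i ≤ j →
  readAs D q i ≡ readAs D q j → EventuallyPeriodic (readAs D q) i (j ∸ i)
repeated-state⇒periodic D q {i} {j} i≤j same m i≤m
  with d , refl ← m≤n⇒∃[o]m+o≡n i≤m = begin
  readAs D q (i + d + (j ∸ i)) ≡⟨ cong (readAs D q) shift ⟩
  readAs D q (j + d)           ≡⟨ readAs-+ D q j d ⟩
  readAs D (readAs D q j) d    ≡⟨ cong (λ s → readAs D s d) (sym same) ⟩
  readAs D (readAs D q i) d    ≡⟨ sym (readAs-+ D q i d) ⟩
  readAs D q (i + d)           ∎
  where
  shift : i + d + (j ∸ i) ≡ j + d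
  shift = begin
    i + d + (j ∸ i)   ≡⟨ +-assoc i d (j ∸ i) ⟩
    i + (d + (j ∸ i)) ≡⟨ cong (i +_) (+-comm d (j ∸ i)) ⟩
    i + (j ∸ i + d)   ≡⟨ sym (+-assoc i (j ∸ i) d) ⟩
    i + (j ∸ i) + d   ≡⟨ cong (_+ d) (m+[n∸m]≡n i≤j) ⟩
    j + d             ∎

stateAfter : ∀ {n} → DFA n → ℕ → Fin n
stateAfter D = readAs D (δ D (start D) cent)

odd-multiple-not-period : ∀ {n} {D : DFA n} {k} → SolvesExactly D k →
  ∀ i r → ¬ EventuallyPeriodic (stateAfter D) i ((2 * r + 1) * 2 ^ k)
odd-multiple-not-period {D = D} {k} (yes , no) i r per = case accepted-and-rejected of λ ()
  where
  m = 2 * i * 2 ^ k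
  i≤m : i ≤ m
  i≤m = ≤-trans (m≤m+n i (i + 0)) (m≤m*n (2 * i) (2 ^ k) {{>-nonZero (m^n>0 2 k)}})
  sum-odd : m + (2 * r + 1) * 2 ^ k ≡ (2 * (i + r) + 1) * 2 ^ k
  sum-odd = begin
    2 * i * 2 ^ k + (2 * r + 1) * 2 ^ k ≡⟨ sym (*-distribʳ-+ (2 ^ k) (2 * i) (2 * r + 1)) ⟩
    (2 * i + (2 * r + 1)) * 2 ^ k       ≡⟨ cong (_* 2 ^ k) (sym (+-assoc (2 * i) (2 * r) 1)) ⟩
    (2 * i + 2 * r + 1) * 2 ^ k         ≡⟨ cong (λ x → (x + 1) * 2 ^ k) (sym (*-distribˡ-+ 2 i r)) ⟩
    (2 * (i + r) + 1) * 2 ^ k           ∎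
  accepted-and-rejected : true ≡ false
  accepted-and-rejected = begin
    true                                  ≡⟨ sym (yes i) ⟩
    accepts D m                           ≡⟨ cong (λ s → accept D (δ D s dollar)) (sym (per m i≤m)) ⟩
    accepts D (m + (2 * r + 1) * 2 ^ k)   ≡⟨ cong (accepts D) sum-odd ⟩
    accepts D ((2 * (i + r) + 1) * 2 ^ k) ≡⟨ no (i + r) ⟩
    false                                 ∎

mainTheorem2 : (k : ℕ) → 1 ≤ k → (n : ℕ) → (D : DFA n) →
    SolvesExactly D k → 2 ^ (k + 1) ≤ n
mainTheorem2 k _ n D solves
  with i , j , i<j , j≤n , same ← repeats-within (stateAfter D)
  with periodic ← repeated-state⇒periodic D _ (<⇒≤ i<j) same
  with pow-∣-or-odd-multiple k (j ∸ i)
... | inj₂ (c , r , c*p≡odd) =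
  ⊥-elim (odd-multiple-not-period {k = k} solves i r
           (subst (EventuallyPeriodic (stateAfter D) i) c*p≡odd (periodic-* periodic c)))
... | inj₁ 2^[k+1]∣p = subst (_≤ n) (cong (2 ^_) (+-comm 1 k))
  (≤-trans (∣⇒≤ {{>-nonZero (m<n⇒0<n∸m i<j)}} 2^[k+1]∣p) (≤-trans (m∸n≤m j i) j≤n))
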